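{- Let $$F(x,y,z)=\sum_{\ell,m,k\ge0}\frac{\ell+1}{k+\ell+1}\binom{k+\ell+m}{k+\ell}\binom{2k+\ell+m}{k+\ell+m}x^ky^\ell z^m,$$ $$G(x,y,z)=\sum_{\ell,m,k\ge0}\binom{k+\ell+m}{k+\ell}\binom{2k+\ell+m-1}{k+\ell+m-1}x^ky^\ell z^m,$$ as formal power series, where the coefficient $\binom{ -1}{ -1}$ occurring for $k=\ell=m=0$ is taken to be $1$. Then $\partial_yG=F\,G$. -}

module Defs where

open import Data.Nat as ℕ using (ℕ; zero; suc; _∸_)
open import Data.Nat.Combinatorics using (_C_)
open import Data.Integer using (+_)
open import Data.Rational using (ℚ; _/_; _+_; _*_; 0ℚ)

-- Formal power series in x, y, z over ℚ, given by their coefficient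
-- function: S k ℓ m is the coefficient of x^k y^ℓ z^m.
PS : Set
PS = ℕ → ℕ → ℕ → ℚ

ℕ→ℚ : ℕ → ℚ
ℕ→ℚ n = + n / 1

sumTo : ℕ → (ℕ → ℚ) → ℚ
sumTo zero    f = f 0
sumTo (suc n) f = sumTo n f + f (suc n)

_·ₚ_ : PS → PS → PS
(A ·ₚ B) k ℓ m =
  sumTo k λ a → sumTo ℓ λ b → sumTo m λ c →
    A a b c * B (k ∸ a) (ℓ ∸ b) (m ∸ c)

∂y : PS → PS
∂y A k ℓ m = ℕ→ℚ (suc ℓ) * A k (suc ℓ) m

F : PS
F k ℓ m =
  (+ (suc ℓ) / suc (k ℕ.+ ℓ))
  * ℕ→ℚ (((k ℕ.+ ℓ ℕ.+ m) C (k ℕ.+ ℓ))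
         ℕ.* ((2 ℕ.* k ℕ.+ ℓ ℕ.+ m) C (k ℕ.+ ℓ ℕ.+ m)))

G : PS
G zero zero zero = ℕ→ℚ 1
G k ℓ m =
  ℕ→ℚ (((k ℕ.+ ℓ ℕ.+ m) C (k ℕ.+ ℓ))
       ℕ.* ((2 ℕ.* k ℕ.+ ℓ ℕ.+ m ∸ 1) C (k ℕ.+ ℓ ℕ.+ m ∸ 1)))

{-# OPTIONS --safe #-}
-- Let u = u(x, z) be the power series with u = 1 + z u + x u². The powers u^n and the
-- y-slices G_ℓ(x, z) of G both satisfy S (n + 1) = S n + z S (n + 1) + x S (n + 2), a
-- recurrence that determines the whole family from S 0; hence u^p G_j = G_(p + j).
-- The y-slices of F are F_ℓ = u^(ℓ + 1), so the y^ℓ coefficient of F G is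
-- Σ_(b ≤ ℓ) u^(b + 1) G_(ℓ - b) = (ℓ + 1) G_(ℓ + 1), which is that of ∂y G.
-- The identifications are coefficientwise binomial identities: [x^k z^m] u^n is a
-- ballot number times a multiset coefficient, and the coefficients of G are those of
-- K_e = (1 + x)^e (1 + x z) / (1 - z)^(e + 2), which satisfy (1 - z) K_(e+1) = (1 + x) K_e.
module Submission where

open import Defs
open import Data.Nat using (ℕ)
open import Relation.Binary.PropositionalEquality using (_≡_)

open import Level using (0ℓ)
open import Data.Nat using (zero; suc; _∸_)
open import Algebra.Bundles.Raw using (RawMonoid)
open import Relation.Binary.PropositionalEquality using (refl; sym; trans; cong; cong₂)

module Recurrence (M : RawMonoid 0ℓ 0ℓ) where
  open RawMonoid M renaming (Carrier to A; _∙_ to _+_; ε to 0#)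

  shift : (ℕ → A) → ℕ → A
  shift f zero    = 0#
  shift f (suc n) = f n

  z·_ x·_ : (ℕ → ℕ → A) → ℕ → ℕ → A
  (z· f) k m = shift (f k) m
  (x· f) k m = shift (λ i → f i m) k

  Recurrent : (ℕ → ℕ → ℕ → A) → Set
  Recurrent S = ∀ n k m → S (suc n) k m ≡ S n k m + (z· S (suc n)) k m + (x· S (suc (suc n))) k m

  module _ {S T : ℕ → ℕ → ℕ → A} (recS : Recurrent S) (recT : Recurrent T)
           (S₀≡T₀ : ∀ k m → S 0 k m ≡ T 0 k m) where

    private
      step : ∀ n k m → S n k m ≡ T n k m →
             (z· S (suc n)) k m ≡ (z· T (suc n)) k m →
             (x· S (suc (suc n))) k m ≡ (x· T (suc (suc n))) k m →
             S (suc n) k m ≡ T (suc n) k m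
      step n k m eq eqᶻ eqˣ =
        trans (recS n k m) (trans (cong₂ _+_ (cong₂ _+_ eq eqᶻ) eqˣ) (sym (recT n k m)))

    -- The recurrence computes S (1 + n) k m from entries that are smaller in
    -- the lexicographic order on (k, m, n).
    recurrent-unique : ∀ n k m → S n k m ≡ T n k m
    recurrent-unique zero    k       m       = S₀≡T₀ k m
    recurrent-unique (suc n) zero    zero    = step n 0 0 (recurrent-unique n 0 0) refl refl
    recurrent-unique (suc n) zero    (suc m) =
      step n 0 (suc m) (recurrent-unique n 0 (suc m)) (recurrent-unique (suc n) 0 m) refl
    recurrent-unique (suc n) (suc k) zero    =
      step n (suc k) 0 (recurrent-unique n (suc k) 0) refl (recurrent-unique (suc (suc n)) k 0)
    recurrent-unique (suc n) (suc k) (suc m) =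
      step n (suc k) (suc m) (recurrent-unique n (suc k) (suc m))
        (recurrent-unique (suc n) (suc k) m) (recurrent-unique (suc (suc n)) k (suc m))

module Coefficients where
  open import Data.Nat
  open import Data.Nat.Properties
  open import Data.Nat.Combinatorics
  open import Data.Nat.DivMod using (m/n*n≡m)
  open import Data.Nat.Tactic.RingSolver using (solve; solve-∀)
  open import Data.List.Base using (_∷_; [])
  open import Algebra.Properties.CommutativeSemigroup +-commutativeSemigroup
    using () renaming (interchange to +-interchange)
  open import Algebra.Properties.CommutativeSemigroup *-commutativeSemigroup
    using (x∙yz≈y∙xz; xy∙z≈yz∙x) renaming (interchange to *-interchange)
  open import Relation.Binary.PropositionalEquality using (module ≡-Reasoning)
  open ≡-Reasoning
  open Recurrence +-0-rawMonoid

  binom : ℕ → ℕ → ℕ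
  binom a b = (a + b) C a

  nCa≡nCb : ∀ {n} a b → a + b ≡ n → n C a ≡ n C b
  nCa≡nCb a b refl = trans (nCk≡nC[n∸k] (m≤m+n a b)) (cong ((a + b) C_) (m+n∸m≡n a b))

  binom-comm : ∀ a b → binom a b ≡ binom b a
  binom-comm a b = trans (nCa≡nCb a b refl) (cong (_C b) (+-comm a b))

  binom*[a!*b!]≡[a+b]! : ∀ a b → binom a b * (a ! * b !) ≡ (a + b) !
  binom*[a!*b!]≡[a+b]! a b = begin
    binom a b * (a ! * b !)               ≡⟨ cong (λ c → binom a b * (a ! * c !)) (m+n∸m≡n a b) ⟨
    binom a b * (a ! * (a + b ∸ a) !)     ≡⟨ cong (_* (a ! * (a + b ∸ a) !)) (nCk≡n!/k![n-k]! a≤a+b) ⟩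
    (a + b) ! / (a ! * (a + b ∸ a) !) * (a ! * (a + b ∸ a) !)
                                          ≡⟨ m/n*n≡m (k![n∸k]!∣n! a≤a+b) ⟩
    (a + b) !                             ∎
    where
    a≤a+b = m≤m+n a b
    instance _ = a !* (a + b ∸ a) !≢0

  binom-pascal : ∀ a b → binom (suc a) (suc b) ≡ binom a (suc b) + binom (suc a) b
  binom-pascal a b = begin
    suc (a + suc b) C suc a                 ≡⟨ nCk+nC[k+1]≡[n+1]C[k+1] (a + suc b) a ⟨
    (a + suc b) C a + (a + suc b) C suc a   ≡⟨ cong (λ n → binom a (suc b) + n C suc a) (+-suc a b) ⟩
    binom a (suc b) + binom (suc a) b       ∎

  private
    binom*binom*factorials : ∀ x y z → binom x y * binom (x + y) z * (x ! * y ! * z !) ≡ (x + y + z) !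
    binom*binom*factorials x y z = begin
      binom x y * binom (x + y) z * (x ! * y ! * z !)
        ≡⟨ *-interchange (binom x y) (binom (x + y) z) (x ! * y !) (z !) ⟩
      binom x y * (x ! * y !) * (binom (x + y) z * z !)
        ≡⟨ cong (_* (binom (x + y) z * z !)) (binom*[a!*b!]≡[a+b]! x y) ⟩
      (x + y) ! * (binom (x + y) z * z !)
        ≡⟨ x∙yz≈y∙xz ((x + y) !) (binom (x + y) z) (z !) ⟩
      binom (x + y) z * ((x + y) ! * z !)
        ≡⟨ binom*[a!*b!]≡[a+b]! (x + y) z ⟩
      (x + y + z) ! ∎

  binom-trinomial : ∀ x y z → binom x y * binom (x + y) z ≡ binom y z * binom (y + z) x
  binom-trinomial x y z = *-cancelʳ-≡ _ _ (x ! * y ! * z !) {{x!y!z!≢0}} (begin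
    binom x y * binom (x + y) z * (x ! * y ! * z !)   ≡⟨ binom*binom*factorials x y z ⟩
    (x + y + z) !                                     ≡⟨ cong _! (rotate x y z) ⟩
    (y + z + x) !                                     ≡⟨ binom*binom*factorials y z x ⟨
    binom y z * binom (y + z) x * (y ! * z ! * x !)
      ≡⟨ cong (binom y z * binom (y + z) x *_) (xy∙z≈yz∙x (x !) (y !) (z !)) ⟨
    binom y z * binom (y + z) x * (x ! * y ! * z !)   ∎)
    where
    x!y!z!≢0 = m*n≢0 (x ! * y !) (z !) {{x !* y !≢0}} {{z !≢0}}
    rotate : ∀ a b c → a + b + c ≡ b + c + a
    rotate = solve-∀

  binom-absorption : ∀ x y → suc y * binom x (suc y) ≡ suc x * binom (suc x) y
  binom-absorption x y = *-cancelʳ-≡ _ _ (x ! * y !) {{x !* y !≢0}} (begin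
    suc y * binom x (suc y) * (x ! * y !)   ≡⟨ reassocˡ (suc y) (binom x (suc y)) (x !) (y !) ⟩
    binom x (suc y) * (x ! * suc y !)       ≡⟨ binom*[a!*b!]≡[a+b]! x (suc y) ⟩
    (x + suc y) !                           ≡⟨ cong _! (+-suc x y) ⟩
    (suc x + y) !                           ≡⟨ binom*[a!*b!]≡[a+b]! (suc x) y ⟨
    binom (suc x) y * (suc x ! * y !)       ≡⟨ reassocʳ (suc x) (binom (suc x) y) (x !) (y !) ⟨
    suc x * binom (suc x) y * (x ! * y !)   ∎)
    where
    reassocˡ : ∀ s a p q → s * a * (p * q) ≡ a * (p * (s * q))
    reassocˡ = solve-∀
    reassocʳ : ∀ s a p q → s * a * (p * q) ≡ a * (s * p * q)
    reassocʳ = solve-∀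

  shift-* : ∀ f c m → shift f m * c ≡ shift (λ i → f i * c) m
  shift-* f c zero    = refl
  shift-* f c (suc m) = refl

  *-shift : ∀ c f k → c * shift f k ≡ shift (λ i → c * f i) k
  *-shift c f zero    = *-zeroʳ c
  *-shift c f (suc k) = refl

  shift-+ : ∀ f g m → shift (λ i → f i + g i) m ≡ shift f m + shift g m
  shift-+ f g zero    = refl
  shift-+ f g (suc m) = refl

  product-step : ∀ a₀ a′ b₀ b′ {a₁ b₁} → a₁ ≡ a₀ + a′ → b₁ ≡ b₀ + b′ →
                 a₁ * b₁ ≡ a₀ * b₀ + a′ * b₁ + a₀ * b′
  product-step a₀ a′ b₀ b′ refl refl = solve (a₀ ∷ a′ ∷ b₀ ∷ b′ ∷ [])

  C-pascal : ∀ n k → suc n C k ≡ n C k + shift (n C_) k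
  C-pascal n zero    = refl
  C-pascal n (suc k) = trans (sym (nCk+nC[k+1]≡[n+1]C[k+1] n k)) (+-comm (n C k) (n C suc k))

  -- multichoose n m = C(n + m - 1, m) = [z^m] (1 - z)^-n
  multichoose : ℕ → ℕ → ℕ
  multichoose n       zero    = 1
  multichoose zero    (suc m) = 0
  multichoose (suc n) (suc m) = multichoose n (suc m) + multichoose (suc n) m

  multichoose-pascal : ∀ n m → multichoose (suc n) m ≡ multichoose n m + shift (multichoose (suc n)) m
  multichoose-pascal n zero    = refl
  multichoose-pascal n (suc m) = refl

  multichoose-suc : ∀ n m → multichoose (suc n) m ≡ binom n m
  multichoose-suc n       zero    = sym (trans (cong (_C n) (+-identityʳ n)) (nCn≡1 n))
  multichoose-suc zero    (suc m) = multichoose-suc zero m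
  multichoose-suc (suc n) (suc m) = begin
    multichoose (suc n) (suc m) + multichoose (suc (suc n)) m
      ≡⟨ cong₂ _+_ (multichoose-suc n (suc m)) (multichoose-suc (suc n) m) ⟩
    binom n (suc m) + binom (suc n) m
      ≡⟨ binom-pascal n m ⟨
    binom (suc n) (suc m) ∎

  -- ballot n k = [x^k] c(x)^n for the Catalan series c = 1 + x c²
  ballot : ℕ → ℕ → ℕ
  ballot zero    zero    = 1
  ballot zero    (suc k) = 0
  ballot (suc n) zero    = 1
  ballot (suc n) (suc k) = ballot n (suc k) + ballot (suc (suc n)) k

  ballot-pascal : ∀ n k → ballot (suc n) k ≡ ballot n k + shift (ballot (suc (suc n))) k
  ballot-pascal zero    zero    = refl
  ballot-pascal (suc n) zero    = refl
  ballot-pascal n       (suc k) = refl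

  private
    reflection-step : ∀ {b₁ b₂} M k → b₁ + M C k ≡ M C suc k → b₂ + shift (M C_) k ≡ M C k →
                      b₁ + b₂ + suc M C k ≡ suc M C suc k
    reflection-step {b₁} {b₂} M k eq₁ eq₂ = begin
      b₁ + b₂ + suc M C k                  ≡⟨ cong (b₁ + b₂ +_) (C-pascal M k) ⟩
      b₁ + b₂ + (M C k + shift (M C_) k)   ≡⟨ +-interchange b₁ b₂ (M C k) (shift (M C_) k) ⟩
      b₁ + M C k + (b₂ + shift (M C_) k)   ≡⟨ cong₂ _+_ eq₁ eq₂ ⟩
      M C suc k + M C k                    ≡⟨ C-pascal M (suc k) ⟨
      suc M C suc k                        ∎

  ballot-reflection : ∀ ℓ k {N} → k + (k + ℓ) ≡ N → ballot (suc ℓ) k + shift (N C_) k ≡ N C k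
  ballot-reflection ℓ       zero    _ = refl
  ballot-reflection ℓ       (suc k) {zero} ()
  ballot-reflection zero    (suc k) {suc M} eq =
    reflection-step M k (nCa≡nCb k (suc k) k+[1+k]≡M) (ballot-reflection 1 k k+[k+1]≡M)
    where
    k+[1+k]≡M : k + suc k ≡ M
    k+[1+k]≡M = trans (cong (λ j → k + suc j) (sym (+-identityʳ k))) (suc-injective eq)
    k+[k+1]≡M : k + (k + 1) ≡ M
    k+[k+1]≡M = trans (cong (k +_) (+-comm k 1)) k+[1+k]≡M
  ballot-reflection (suc ℓ) (suc k) {suc M} eq =
    reflection-step M k (ballot-reflection ℓ (suc k) (trans index₁ M≡))
                        (ballot-reflection (suc (suc ℓ)) k (trans index₂ M≡))
    where
    M≡ = suc-injective eq
    index₁ : suc k + (suc k + ℓ) ≡ k + suc (k + suc ℓ)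
    index₁ = solve (k ∷ ℓ ∷ [])
    index₂ : k + (k + suc (suc ℓ)) ≡ k + suc (k + suc ℓ)
    index₂ = solve (k ∷ ℓ ∷ [])

  private
    shift-absorption : ∀ k ℓ → suc (k + ℓ) * shift ((k + (k + ℓ)) C_) k ≡ k * binom k (k + ℓ)
    shift-absorption zero    ℓ = *-zeroʳ (suc ℓ)
    shift-absorption (suc k) ℓ =
      trans (cong (λ n → suc (suc (k + ℓ)) * (n C k)) (sym (+-suc k (suc (k + ℓ)))))
            (binom-absorption k (suc (k + ℓ)))

  ballot-closed : ∀ k ℓ → suc (k + ℓ) * ballot (suc ℓ) k ≡ suc ℓ * binom k (k + ℓ)
  ballot-closed k ℓ = +-cancelʳ-≡ (k * c) _ _ (begin
    s * ballot (suc ℓ) k + k * c                   ≡⟨ cong (s * ballot (suc ℓ) k +_) (shift-absorption k ℓ) ⟨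
    s * ballot (suc ℓ) k + s * shift (N C_) k       ≡⟨ *-distribˡ-+ s (ballot (suc ℓ) k) (shift (N C_) k) ⟨
    s * (ballot (suc ℓ) k + shift (N C_) k)         ≡⟨ cong (s *_) (ballot-reflection ℓ k refl) ⟩
    s * c                                           ≡⟨ cong (λ j → suc j * c) (+-comm k ℓ) ⟩
    (suc ℓ + k) * c                                 ≡⟨ *-distribʳ-+ c (suc ℓ) k ⟩
    suc ℓ * c + k * c                               ∎)
    where
    s = suc (k + ℓ)
    N = k + (k + ℓ)
    c = binom k (k + ℓ)

  -- U n k m = [x^k z^m] u^n, where u = c(x / (1 - z)²) / (1 - z)
  U : ℕ → ℕ → ℕ → ℕ
  U n k m = multichoose (n + (k + k)) m * ballot n k

  U-recurrent : Recurrent U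
  U-recurrent n k m = begin
    U (suc n) k m
      ≡⟨ product-step (multichoose (n + (k + k)) m) (shift (multichoose (suc n + (k + k))) m)
                      (ballot n k) (shift (ballot (suc (suc n))) k)
                      (multichoose-pascal (n + (k + k)) m) (ballot-pascal n k) ⟩
    U n k m + shift (multichoose (suc n + (k + k))) m * ballot (suc n) k
            + multichoose (n + (k + k)) m * shift (ballot (suc (suc n))) k
      ≡⟨ cong₂ (λ p q → U n k m + p + q) (shift-* _ (ballot (suc n) k) m) (x-part k) ⟩
    U n k m + (z· U (suc n)) k m + (x· U (suc (suc n))) k m ∎
    where
    x-part : ∀ i → multichoose (n + (i + i)) m * shift (ballot (suc (suc n))) i ≡ (x· U (suc (suc n))) i m
    x-part zero    = *-zeroʳ (multichoose (n + 0) m)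
    x-part (suc i) = cong (λ j → multichoose j m * ballot (suc (suc n)) i) index
      where
      index : n + (suc i + suc i) ≡ suc (suc n) + (i + i)
      index = solve (n ∷ i ∷ [])

  -- (1 - z) P (1 + e) = (1 + x) P e
  RatioRecurrent : (ℕ → ℕ → ℕ → ℕ) → Set
  RatioRecurrent P = ∀ e k m → P (suc e) k m ≡ P e k m + (z· P (suc e)) k m + (x· P e) k m

  product-ratioRecurrent : ∀ {A B : ℕ → ℕ → ℕ} →
    (∀ e m → A (suc e) m ≡ A e m + shift (A (suc e)) m) →
    (∀ e k → B (suc e) k ≡ B e k + shift (B e) k) →
    RatioRecurrent (λ e k m → A e m * B e k)
  product-ratioRecurrent {A} {B} recA recB e k m =
    trans (product-step (A e m) (shift (A (suc e)) m) (B e k) (shift (B e) k) (recA e m) (recB e k))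
          (cong₂ (λ p q → A e m * B e k + p + q) (shift-* (A (suc e)) (B (suc e) k) m) (*-shift (A e m) (B e) k))

  +-ratioRecurrent : ∀ {P Q} → RatioRecurrent P → RatioRecurrent Q →
                     RatioRecurrent (λ e k m → P e k m + Q e k m)
  +-ratioRecurrent {P} {Q} recP recQ e k m = begin
    P (suc e) k m + Q (suc e) k m
      ≡⟨ cong₂ _+_ (recP e k m) (recQ e k m) ⟩
    (p + zp + xp) + (q + zq + xq)
      ≡⟨ +-interchange (p + zp) xp (q + zq) xq ⟩
    (p + zp + (q + zq)) + (xp + xq)
      ≡⟨ cong (_+ (xp + xq)) (+-interchange p zp q zq) ⟩
    (p + q) + (zp + zq) + (xp + xq)
      ≡⟨ cong₂ (λ s t → p + q + s + t) (shift-+ (P (suc e) k) (Q (suc e) k) m)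
                                       (shift-+ (λ i → P e i m) (λ i → Q e i m) k) ⟨
    (p + q) + (z· (λ k m → P (suc e) k m + Q (suc e) k m)) k m + (x· (λ k m → P e k m + Q e k m)) k m ∎
    where
    p = P e k m
    q = Q e k m
    zp = (z· P (suc e)) k m
    zq = (z· Q (suc e)) k m
    xp = (x· P e) k m
    xq = (x· Q e) k m

  -- K e = (1 + x)^e (1 + x z) / (1 - z)^(e + 2); the coefficients of G at y^ℓ are K (2k + ℓ - 1).
  K : ℕ → ℕ → ℕ → ℕ
  K e k m = multichoose (suc e) m * (e C k) + shift (multichoose (suc (suc e))) m * (suc e C k)

  K-ratioRecurrent : RatioRecurrent K
  K-ratioRecurrent =
    +-ratioRecurrent (product-ratioRecurrent (λ e → multichoose-pascal (suc e)) C-pascal)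
                     (product-ratioRecurrent shifted-pascal (λ e → C-pascal (suc e)))
    where
    shifted-pascal : ∀ e m → shift (multichoose (3 + e)) m
                           ≡ shift (multichoose (2 + e)) m + shift (shift (multichoose (3 + e))) m
    shifted-pascal e zero    = refl
    shifted-pascal e (suc m) = multichoose-pascal (suc (suc e)) m

  K-origin : ∀ m → K 0 0 m ≡ suc m
  K-origin zero    = refl
  K-origin (suc m) =
    trans (cong₂ (λ a b → a * 1 + b * 1) (multichoose-suc 0 (suc m)) (trans (multichoose-suc 1 m) (nC1≡n (suc m))))
          (cong suc (*-identityʳ (suc m)))

  H : ℕ → ℕ → ℕ → ℕ
  H ℓ       (suc k) m = K (suc k + (k + ℓ)) (suc k) m
  H zero    zero    m = 1
  H (suc ℓ) zero    m = K ℓ zero m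

  H-recurrent : Recurrent H
  H-recurrent zero    zero    zero    = refl
  H-recurrent zero    zero    (suc m) =
    trans (K-origin (suc m)) (sym (trans (+-identityʳ (suc (K 0 0 m))) (cong suc (K-origin m))))
  H-recurrent (suc ℓ) zero    m       = K-ratioRecurrent ℓ 0 m
  H-recurrent ℓ       (suc k) m       = begin
    K (suc k + (k + suc ℓ)) (suc k) m
      ≡⟨ cong (λ e → K e (suc k) m) index ⟩
    K (suc e) (suc k) m
      ≡⟨ K-ratioRecurrent e (suc k) m ⟩
    K e (suc k) m + (z· K (suc e)) (suc k) m + K e k m
      ≡⟨ cong₂ (λ a b → K e (suc k) m + a + b) (cong (λ e → (z· K e) (suc k) m) (sym index)) (x-part k) ⟩
    H ℓ (suc k) m + (z· H (suc ℓ)) (suc k) m + (x· H (suc (suc ℓ))) (suc k) m ∎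
    where
    e = suc k + (k + ℓ)
    index : suc k + (k + suc ℓ) ≡ suc (suc k + (k + ℓ))
    index = solve (k ∷ ℓ ∷ [])
    x-part : ∀ i → K (suc i + (i + ℓ)) i m ≡ H (suc (suc ℓ)) i m
    x-part zero    = refl
    x-part (suc i) = cong (λ e → K e (suc i) m) index′
      where
      index′ : suc (suc i) + (suc i + ℓ) ≡ suc i + (i + suc (suc ℓ))
      index′ = solve (i ∷ ℓ ∷ [])

  binom-product≡K : ∀ n k m → binom (suc n) m * binom (n + m) k ≡ K (k + n) k m
  binom-product≡K n k zero = begin
    binom (suc n) 0 * binom (n + 0) k
      ≡⟨ cong₂ _*_ (sym (multichoose-suc (suc n) 0))
                   (trans (binom-comm (n + 0) k) (cong (binom k) (+-identityʳ n))) ⟩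
    1 * binom k n
      ≡⟨ +-identityʳ (1 * binom k n) ⟨
    K (k + n) k 0 ∎
  binom-product≡K n k (suc m) = begin
    binom (suc n) (suc m) * B                  ≡⟨ cong (_* B) (binom-pascal n m) ⟩
    (binom n (suc m) + binom (suc n) m) * B    ≡⟨ *-distribʳ-+ B (binom n (suc m)) (binom (suc n) m) ⟩
    binom n (suc m) * B + binom (suc n) m * B  ≡⟨ cong₂ _+_ first second ⟩
    K (k + n) k (suc m)                        ∎
    where
    B = binom (n + suc m) k
    first : binom n (suc m) * B ≡ multichoose (suc (k + n)) (suc m) * binom k n
    first = begin
      binom n (suc m) * binom (n + suc m) k           ≡⟨ binom-trinomial k n (suc m) ⟨
      binom k n * binom (k + n) (suc m)               ≡⟨ *-comm (binom k n) (binom (k + n) (suc m)) ⟩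
      binom (k + n) (suc m) * binom k n               ≡⟨ cong (_* binom k n) (multichoose-suc (k + n) (suc m)) ⟨
      multichoose (suc (k + n)) (suc m) * binom k n   ∎
    second : binom (suc n) m * B ≡ multichoose (suc (suc (k + n))) m * (suc (k + n) C k)
    second = begin
      binom (suc n) m * binom (n + suc m) k           ≡⟨ cong (λ j → binom (suc n) m * binom j k) (+-suc n m) ⟩
      binom (suc n) m * binom (suc n + m) k           ≡⟨ binom-trinomial k (suc n) m ⟨
      binom k (suc n) * binom (k + suc n) m           ≡⟨ *-comm (binom k (suc n)) (binom (k + suc n) m) ⟩
      binom (k + suc n) m * binom k (suc n)           ≡⟨ cong (_* binom k (suc n)) (multichoose-suc (k + suc n) m) ⟨
      multichoose (suc (k + suc n)) m * binom k (suc n)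
                                                      ≡⟨ cong (λ j → multichoose (suc j) m * (j C k)) (+-suc k n) ⟩
      multichoose (suc (suc (k + n))) m * (suc (k + n) C k) ∎

  U-closed-form : ∀ k ℓ m →
    suc (k + ℓ) * U (suc ℓ) k m ≡ suc ℓ * (binom (k + ℓ) m * ((2 * k + ℓ + m) C (k + ℓ + m)))
  U-closed-form k ℓ m = begin
    suc (k + ℓ) * (a * ballot (suc ℓ) k)   ≡⟨ x∙yz≈y∙xz (suc (k + ℓ)) a (ballot (suc ℓ) k) ⟩
    a * (suc (k + ℓ) * ballot (suc ℓ) k)   ≡⟨ cong (a *_) (ballot-closed k ℓ) ⟩
    a * (suc ℓ * binom k (k + ℓ))          ≡⟨ x∙yz≈y∙xz a (suc ℓ) (binom k (k + ℓ)) ⟩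
    suc ℓ * (a * binom k (k + ℓ))          ≡⟨ cong (suc ℓ *_) trinomial ⟩
    suc ℓ * (binom (k + ℓ) m * ((2 * k + ℓ + m) C (k + ℓ + m))) ∎
    where
    a = multichoose (suc ℓ + (k + k)) m
    index₁ : ℓ + (k + k) ≡ k + (k + ℓ)
    index₁ = solve (k ∷ ℓ ∷ [])
    index₂ : k + ℓ + m + k ≡ 2 * k + ℓ + m
    index₂ = solve (k ∷ ℓ ∷ m ∷ [])
    trinomial : a * binom k (k + ℓ) ≡ binom (k + ℓ) m * ((2 * k + ℓ + m) C (k + ℓ + m))
    trinomial = begin
      a * binom k (k + ℓ)                        ≡⟨ cong (_* binom k (k + ℓ)) (multichoose-suc (ℓ + (k + k)) m) ⟩
      binom (ℓ + (k + k)) m * binom k (k + ℓ)    ≡⟨ cong (λ j → binom j m * binom k (k + ℓ)) index₁ ⟩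
      binom (k + (k + ℓ)) m * binom k (k + ℓ)    ≡⟨ *-comm (binom (k + (k + ℓ)) m) (binom k (k + ℓ)) ⟩
      binom k (k + ℓ) * binom (k + (k + ℓ)) m    ≡⟨ binom-trinomial k (k + ℓ) m ⟩
      binom (k + ℓ) m * binom (k + ℓ + m) k      ≡⟨ cong (λ j → binom (k + ℓ) m * (j C (k + ℓ + m))) index₂ ⟩
      binom (k + ℓ) m * ((2 * k + ℓ + m) C (k + ℓ + m)) ∎


open Coefficients using (binom; multichoose; U; H; U-recurrent; H-recurrent; U-closed-form; binom-product≡K)
import Data.Nat as ℕ
import Data.Nat.Properties as ℕ
open import Data.Nat.Combinatorics using (_C_; nCn≡1)
open import Data.Nat.Tactic.RingSolver using (solve)
open import Data.List.Base using (_∷_; [])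
open import Data.Integer using (+_)
import Data.Integer as ℤ
import Data.Integer.Properties as ℤ
open import Data.Rational using (ℚ; _/_; _+_; _*_; 0ℚ; 1ℚ; toℚᵘ; +-0-rawMonoid)
open import Data.Rational.Properties
import Data.Rational.Unnormalised as ℚᵘ
import Data.Rational.Unnormalised.Properties as ℚᵘ
open import Algebra.Bundles using (CommutativeMonoid)
open import Algebra.Properties.CommutativeSemigroup
  (CommutativeMonoid.commutativeSemigroup +-0-commutativeMonoid) using (interchange)
open import Relation.Binary.PropositionalEquality using (module ≡-Reasoning)

toℚᵘ-ℕ→ℚ : ∀ n → toℚᵘ (ℕ→ℚ n) ℚᵘ.≃ ℚᵘ.mkℚᵘ (+ n) 0
toℚᵘ-ℕ→ℚ n = toℚᵘ-fromℚᵘ (ℚᵘ.mkℚᵘ (+ n) 0)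

ℕ→ℚ-homo-+ : ∀ a b → ℕ→ℚ (a ℕ.+ b) ≡ ℕ→ℚ a + ℕ→ℚ b
ℕ→ℚ-homo-+ a b = toℚᵘ-injective (begin
  toℚᵘ (ℕ→ℚ (a ℕ.+ b))                  ≈⟨ toℚᵘ-ℕ→ℚ (a ℕ.+ b) ⟩
  ℚᵘ.mkℚᵘ (+ (a ℕ.+ b)) 0                ≈⟨ ℚᵘ.*≡* cross ⟩
  ℚᵘ.mkℚᵘ (+ a) 0 ℚᵘ.+ ℚᵘ.mkℚᵘ (+ b) 0   ≈⟨ ℚᵘ.+-cong (toℚᵘ-ℕ→ℚ a) (toℚᵘ-ℕ→ℚ b) ⟨
  toℚᵘ (ℕ→ℚ a) ℚᵘ.+ toℚᵘ (ℕ→ℚ b)        ≈⟨ toℚᵘ-homo-+ (ℕ→ℚ a) (ℕ→ℚ b) ⟨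
  toℚᵘ (ℕ→ℚ a + ℕ→ℚ b)                   ∎)
  where
  open ℚᵘ.≃-Reasoning
  cross : + (a ℕ.+ b) ℤ.* + 1 ≡ (+ a ℤ.* + 1 ℤ.+ + b ℤ.* + 1) ℤ.* + 1
  cross = cong (ℤ._* + 1) (trans (ℤ.pos-+ a b)
                                 (sym (cong₂ ℤ._+_ (ℤ.*-identityʳ (+ a)) (ℤ.*-identityʳ (+ b)))))

[s/1+d]*x≡y : ∀ s d x y → suc d ℕ.* y ≡ s ℕ.* x → (+ s / suc d) * ℕ→ℚ x ≡ ℕ→ℚ y
[s/1+d]*x≡y s d x y eq = toℚᵘ-injective (begin
  toℚᵘ ((+ s / suc d) * ℕ→ℚ x)           ≈⟨ toℚᵘ-homo-* (+ s / suc d) (ℕ→ℚ x) ⟩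
  toℚᵘ (+ s / suc d) ℚᵘ.* toℚᵘ (ℕ→ℚ x)   ≈⟨ ℚᵘ.*-cong (toℚᵘ-fromℚᵘ (ℚᵘ.mkℚᵘ (+ s) d)) (toℚᵘ-ℕ→ℚ x) ⟩
  ℚᵘ.mkℚᵘ (+ s) d ℚᵘ.* ℚᵘ.mkℚᵘ (+ x) 0   ≈⟨ ℚᵘ.*≡* cross ⟩
  ℚᵘ.mkℚᵘ (+ y) 0                         ≈⟨ toℚᵘ-ℕ→ℚ y ⟨
  toℚᵘ (ℕ→ℚ y)                            ∎)
  where
  open ℚᵘ.≃-Reasoning
  cross : (+ s ℤ.* + x) ℤ.* + 1 ≡ + y ℤ.* + (suc d ℕ.* 1)
  cross = trans (sym (trans (ℤ.pos-* (s ℕ.* x) 1) (cong (ℤ._* + 1) (ℤ.pos-* s x))))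
                (trans (cong +_ (trans (ℕ.*-identityʳ (s ℕ.* x)) (trans (sym eq) reorder)))
                       (ℤ.pos-* y (suc d ℕ.* 1)))
    where
    reorder : suc d ℕ.* y ≡ y ℕ.* (suc d ℕ.* 1)
    reorder = solve (d ∷ y ∷ [])

sumTo-cong≤ : ∀ n {f g : ℕ → ℚ} → (∀ {i} → i ℕ.≤ n → f i ≡ g i) → sumTo n f ≡ sumTo n g
sumTo-cong≤ zero    eq = eq ℕ.z≤n
sumTo-cong≤ (suc n) eq = cong₂ _+_ (sumTo-cong≤ n (λ i≤n → eq (ℕ.m≤n⇒m≤1+n i≤n))) (eq ℕ.≤-refl)

sumTo-cong : ∀ n {f g : ℕ → ℚ} → (∀ i → f i ≡ g i) → sumTo n f ≡ sumTo n g
sumTo-cong n eq = sumTo-cong≤ n (λ {i} _ → eq i)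

sumTo-distrib-+ : ∀ n (f g : ℕ → ℚ) → sumTo n (λ i → f i + g i) ≡ sumTo n f + sumTo n g
sumTo-distrib-+ zero    f g = refl
sumTo-distrib-+ (suc n) f g =
  trans (cong (_+ (f (suc n) + g (suc n))) (sumTo-distrib-+ n f g))
        (interchange (sumTo n f) (sumTo n g) (f (suc n)) (g (suc n)))

sumTo-zero : ∀ n {f : ℕ → ℚ} → (∀ i → f i ≡ 0ℚ) → sumTo n f ≡ 0ℚ
sumTo-zero zero    eq = eq 0
sumTo-zero (suc n) eq = trans (cong₂ _+_ (sumTo-zero n eq) (eq (suc n))) (+-identityˡ 0ℚ)

sumTo-head : ∀ n {f : ℕ → ℚ} → (∀ i → f (suc i) ≡ 0ℚ) → sumTo n f ≡ f 0
sumTo-head zero        eq = refl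
sumTo-head (suc n) {f} eq = trans (cong₂ _+_ (sumTo-head n eq) (eq n)) (+-identityʳ (f 0))

sumTo-suc : ∀ n (f : ℕ → ℚ) → sumTo (suc n) f ≡ f 0 + sumTo n (λ i → f (suc i))
sumTo-suc zero    f = refl
sumTo-suc (suc n) f = trans (cong (_+ f (suc (suc n))) (sumTo-suc n f)) (+-assoc (f 0) _ _)

sumTo-comm : ∀ k l (f : ℕ → ℕ → ℚ) →
             sumTo k (λ a → sumTo l (f a)) ≡ sumTo l (λ b → sumTo k (λ a → f a b))
sumTo-comm zero    l f = refl
sumTo-comm (suc k) l f =
  trans (cong (_+ sumTo l (f (suc k))) (sumTo-comm k l f))
        (sym (sumTo-distrib-+ l (λ b → sumTo k (λ a → f a b)) (f (suc k))))

sumTo-const : ∀ n v → sumTo n (λ _ → v) ≡ ℕ→ℚ (suc n) * v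
sumTo-const zero    v = sym (*-identityˡ v)
sumTo-const (suc n) v = begin
  sumTo n (λ _ → v) + v          ≡⟨ cong (_+ v) (sumTo-const n v) ⟩
  ℕ→ℚ (suc n) * v + v            ≡⟨ +-comm (ℕ→ℚ (suc n) * v) v ⟩
  v + ℕ→ℚ (suc n) * v            ≡⟨ cong (_+ ℕ→ℚ (suc n) * v) (*-identityˡ v) ⟨
  1ℚ * v + ℕ→ℚ (suc n) * v       ≡⟨ *-distribʳ-+ v 1ℚ (ℕ→ℚ (suc n)) ⟨
  (1ℚ + ℕ→ℚ (suc n)) * v         ≡⟨ cong (_* v) (ℕ→ℚ-homo-+ 1 (suc n)) ⟨
  ℕ→ℚ (suc (suc n)) * v          ∎
  where open ≡-Reasoning

open Recurrence +-0-rawMonoid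
private module ℕ-Recurrence = Recurrence ℕ.+-0-rawMonoid

⟦_⟧ : (ℕ → ℕ → ℕ) → ℕ → ℕ → ℚ
⟦ f ⟧ k m = ℕ→ℚ (f k m)

ℕ→ℚ-shift : ∀ f m → ℕ→ℚ (ℕ-Recurrence.shift f m) ≡ shift (λ i → ℕ→ℚ (f i)) m
ℕ→ℚ-shift f zero    = refl
ℕ→ℚ-shift f (suc m) = refl

ℕ→ℚ-recurrent : ∀ {S} → ℕ-Recurrence.Recurrent S → Recurrent (λ n → ⟦ S n ⟧)
ℕ→ℚ-recurrent {S} recS n k m =
  trans (cong ℕ→ℚ (recS n k m))
        (trans (ℕ→ℚ-homo-+ (S n k m ℕ.+ zS) xS)
               (cong₂ _+_ (trans (ℕ→ℚ-homo-+ (S n k m) zS)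
                                 (cong (λ t → ⟦ S n ⟧ k m + t) (ℕ→ℚ-shift (S (suc n) k) m)))
                          (ℕ→ℚ-shift (λ i → S (suc (suc n)) i m) k)))
  where
  zS = (ℕ-Recurrence.z· S (suc n)) k m
  xS = (ℕ-Recurrence.x· S (suc (suc n))) k m

infixl 7 _⋆_
_⋆_ : (ℕ → ℕ → ℚ) → (ℕ → ℕ → ℚ) → ℕ → ℕ → ℚ
(f ⋆ g) k m = sumTo k λ a → sumTo m λ c → f a c * g (k ∸ a) (m ∸ c)

⋆-congˡ : ∀ {f f′} g → (∀ a c → f a c ≡ f′ a c) → ∀ k m → (f ⋆ g) k m ≡ (f′ ⋆ g) k m
⋆-congˡ g eq k m = sumTo-cong k λ a → sumTo-cong m λ c → cong (_* g (k ∸ a) (m ∸ c)) (eq a c)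

⋆-distribʳ-+ : ∀ f f′ g k m → ((λ a c → f a c + f′ a c) ⋆ g) k m ≡ (f ⋆ g) k m + (f′ ⋆ g) k m
⋆-distribʳ-+ f f′ g k m =
  trans (sumTo-cong k λ a → trans (sumTo-cong m λ c → *-distribʳ-+ (g (k ∸ a) (m ∸ c)) (f a c) (f′ a c))
                                  (sumTo-distrib-+ m _ _))
        (sumTo-distrib-+ k _ _)

z·-⋆ : ∀ f g k m → ((z· f) ⋆ g) k m ≡ (z· (f ⋆ g)) k m
z·-⋆ f g k zero    = sumTo-zero k λ a → *-zeroˡ (g (k ∸ a) 0)
z·-⋆ f g k (suc m) = sumTo-cong k λ a →
  trans (sumTo-suc m _) (trans (cong (_+ rest a) (*-zeroˡ (g (k ∸ a) (suc m)))) (+-identityˡ (rest a)))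
  where
  rest : ℕ → ℚ
  rest a = sumTo m λ c → f a c * g (k ∸ a) (m ∸ c)

x·-⋆ : ∀ f g k m → ((x· f) ⋆ g) k m ≡ (x· (f ⋆ g)) k m
x·-⋆ f g zero    m = sumTo-zero m λ c → *-zeroˡ (g 0 (m ∸ c))
x·-⋆ f g (suc k) m =
  trans (sumTo-suc k _) (trans (cong (_+ (f ⋆ g) k m) (sumTo-zero m λ c → *-zeroˡ (g (suc k) (m ∸ c))))
                               (+-identityˡ ((f ⋆ g) k m)))

𝟙 : ℕ → ℕ → ℚ
𝟙 zero    zero    = 1ℚ
𝟙 zero    (suc m) = 0ℚ
𝟙 (suc k) m       = 0ℚ

⋆-identityˡ : ∀ g k m → (𝟙 ⋆ g) k m ≡ g k m
⋆-identityˡ g k m =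
  trans (sumTo-head k λ a → sumTo-zero m λ c → *-zeroˡ (g (k ∸ suc a) (m ∸ c)))
        (trans (sumTo-head m λ c → *-zeroˡ (g k (m ∸ suc c))) (*-identityˡ (g k m)))

⋆-recurrent : ∀ {S} → Recurrent S → ∀ g → Recurrent (λ n → S n ⋆ g)
⋆-recurrent {S} recS g n k m = begin
  (S (suc n) ⋆ g) k m
    ≡⟨ ⋆-congˡ g (recS n) k m ⟩
  ((λ a c → S n a c + (z· S (suc n)) a c + (x· S (suc (suc n))) a c) ⋆ g) k m
    ≡⟨ ⋆-distribʳ-+ (λ a c → S n a c + (z· S (suc n)) a c) (x· S (suc (suc n))) g k m ⟩
  ((λ a c → S n a c + (z· S (suc n)) a c) ⋆ g) k m + ((x· S (suc (suc n))) ⋆ g) k m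
    ≡⟨ cong₂ _+_ (⋆-distribʳ-+ (S n) (z· S (suc n)) g k m) (x·-⋆ (S (suc (suc n))) g k m) ⟩
  (S n ⋆ g) k m + ((z· S (suc n)) ⋆ g) k m + (x· (S (suc (suc n)) ⋆ g)) k m
    ≡⟨ cong (λ t → (S n ⋆ g) k m + t + (x· (S (suc (suc n)) ⋆ g)) k m) (z·-⋆ (S (suc n)) g k m) ⟩
  (S n ⋆ g) k m + (z· (S (suc n) ⋆ g)) k m + (x· (S (suc (suc n)) ⋆ g)) k m ∎
  where open ≡-Reasoning

U₀≡𝟙 : ∀ k m → ⟦ U 0 ⟧ k m ≡ 𝟙 k m
U₀≡𝟙 zero    zero    = refl
U₀≡𝟙 zero    (suc m) = refl
U₀≡𝟙 (suc k) m       = cong ℕ→ℚ (ℕ.*-zeroʳ (multichoose (suc k ℕ.+ suc k) m))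

U⋆H≡H : ∀ p j k m → (⟦ U p ⟧ ⋆ ⟦ H j ⟧) k m ≡ ⟦ H (p ℕ.+ j) ⟧ k m
U⋆H≡H p j = recurrent-unique {S = λ n → ⟦ U n ⟧ ⋆ ⟦ H j ⟧} {T = λ n → ⟦ H (n ℕ.+ j) ⟧}
                             (⋆-recurrent {λ n → ⟦ U n ⟧} (ℕ→ℚ-recurrent {U} U-recurrent) ⟦ H j ⟧)
                             (λ n → ℕ→ℚ-recurrent {H} H-recurrent (n ℕ.+ j))
                             (λ k m → trans (⋆-congˡ ⟦ H j ⟧ U₀≡𝟙 k m) (⋆-identityˡ ⟦ H j ⟧ k m)) p

F≡U : ∀ k ℓ m → F k ℓ m ≡ ⟦ U (suc ℓ) ⟧ k m
F≡U k ℓ m = [s/1+d]*x≡y (suc ℓ) (k ℕ.+ ℓ) _ (U (suc ℓ) k m) (U-closed-form k ℓ m)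

G≡H : ∀ k ℓ m → G k ℓ m ≡ ⟦ H ℓ ⟧ k m
G≡H zero    zero    zero    = refl
G≡H zero    zero    (suc m) = cong (λ c → ℕ→ℚ (1 ℕ.* c)) (nCn≡1 m)
G≡H zero    (suc ℓ) m       =
  cong ℕ→ℚ (trans (cong (λ n → binom (suc ℓ) m ℕ.* (n C (ℓ ℕ.+ m))) (sym (ℕ.+-identityʳ (ℓ ℕ.+ m))))
                  (binom-product≡K ℓ 0 m))
G≡H (suc k) ℓ m       =
  cong ℕ→ℚ (trans (cong (λ n → binom (suc (k ℕ.+ ℓ)) m ℕ.* (n C (k ℕ.+ ℓ ℕ.+ m))) index)
                  (binom-product≡K (k ℕ.+ ℓ) (suc k) m))
  where
  index : k ℕ.+ suc (k ℕ.+ 0) ℕ.+ ℓ ℕ.+ m ≡ k ℕ.+ ℓ ℕ.+ m ℕ.+ suc k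
  index = solve (k ∷ ℓ ∷ m ∷ [])

lemma5 : (k ℓ m : ℕ) → ∂y G k ℓ m ≡ (F ·ₚ G) k ℓ m
lemma5 k ℓ m = sym (begin
  (F ·ₚ G) k ℓ m
    ≡⟨ sumTo-comm k ℓ (λ a b → sumTo m λ c → F a b c * G (k ∸ a) (ℓ ∸ b) (m ∸ c)) ⟩
  sumTo ℓ (λ b → sumTo k λ a → sumTo m λ c → F a b c * G (k ∸ a) (ℓ ∸ b) (m ∸ c))
    ≡⟨ sumTo-cong ℓ (λ b → sumTo-cong k λ a → sumTo-cong m λ c →
         cong₂ _*_ (F≡U a b c) (G≡H (k ∸ a) (ℓ ∸ b) (m ∸ c))) ⟩
  sumTo ℓ (λ b → (⟦ U (suc b) ⟧ ⋆ ⟦ H (ℓ ∸ b) ⟧) k m)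
    ≡⟨ sumTo-cong≤ ℓ (λ {b} b≤ℓ → trans (U⋆H≡H (suc b) (ℓ ∸ b) k m)
                                        (cong (λ j → ⟦ H (suc j) ⟧ k m) (ℕ.m+[n∸m]≡n b≤ℓ))) ⟩
  sumTo ℓ (λ _ → ⟦ H (suc ℓ) ⟧ k m)
    ≡⟨ sumTo-const ℓ (⟦ H (suc ℓ) ⟧ k m) ⟩
  ℕ→ℚ (suc ℓ) * ⟦ H (suc ℓ) ⟧ k m
    ≡⟨ cong (ℕ→ℚ (suc ℓ) *_) (G≡H k (suc ℓ) m) ⟨
  ∂y G k ℓ m ∎)
  where open ≡-Reasoning
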